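{- Let $IP$ be a mixed-integer linear program with $m$ constraints and $\mathtt{cert}$ a VIPR certificate with constraints $C_1,\dots,C_d$, with notation as in the context. For all $m+1\le k\le d$ with $\mathtt{reason}(C_k)=\mathtt{uns}$, $\mathtt{data}(C_k)=(i_1,l_1,i_2,l_2)$, such that all previous derived constraints $C_{m+1},\dots,C_{k-1}$ are valid, $C_k$ is valid if and only if $\phi_{DER}(k)=\mathtt{true}$, where $\phi_{DER}(k)=\phi_{ASM}(k)\wedge(k>i_1)\wedge(k>i_2)\wedge(k>l_1)\wedge(k>l_2)\wedge\phi_{DOM}(C_{i_1},C_k)\wedge\phi_{DOM}(C_{i_2},C_k)\wedge\phi_{DIS}(l_1,l_2)$.
   Context: $IP$ has variables $x\in\mathbb{R}^n$, integer index set $I$, objective $c$, sense $\mathtt{min}$ or $\mathtt{max}$, and constraints $C_1,\dots,C_m$. A constraint $C_i$ has coefficients $a_{i,j}$, rhs $b_i$, sign $s(C_i)\in\{ -1,0,1\}$ ($\le,=,\ge$). A VIPR certificate contains $RTP$, a finite $SOL\subseteq\mathbb{R}^n$, and derived constraints $C_{m+1},\dots,C_d$, each with reason in $\{\mathtt{asm},\mathtt{lin},\mathtt{rnd},\mathtt{uns},\mathtt{sol}\}$, data, and assumption set $\mathtt{A}(C_k)\subseteq S=\{i\in\{m+1,\dots,d\}:\mathtt{reason}(C_i)=\mathtt{asm}\}$; $\mathtt{A}(C_i)=\emptyset$ for $i\le m$. For $\mathtt{lin}/\mathtt{rnd}$, data is $\lambda\in\mathbb{R}^d$ with support $\mathtt{nz}(\mathtt{data}(C_k))$;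 for $\mathtt{uns}$, data is $(i_1,l_1,i_2,l_2)\in[d]^4$. Domination: $(a,b,s)$ is an absurdity if $a=0$ and ($s=0,b\ne0$) or ($s=1,b>0$) or ($s=-1,b<0$); it dominates $(a',b',s')$ if absurd, or $a=a'$ and [$s'=0\Rightarrow s=0,b=b'$], [$s'=1\Rightarrow s\in\{0,1\},b\ge b'$], [$s'=-1\Rightarrow s\in\{0,-1\},b\le b'$]. The combination $\sum_{i\in N}\lambda_iC_i$ has coefficients $\sum\lambda_ia_i$, rhs $\sum\lambda_ib_i$, sign $0$ if all $\lambda_is(C_i)=0$, else $1$ if all $\ge0$, else $-1$ if all $\le0$, else undefined (dominates nothing). Roundable: sign $\pm1$, integer coefficients on $I$, zero off $I$; rounding replaces $b$ by $\lceil b\rceil$ or $\lfloor b\rfloor$ for sign $1$ or $-1$. $C_i,C_j$ form a split disjunction if they have the same coefficient vector $a$ with $a_t\in\mathbb{Z}$ for $t\in I$ and $a_t=0$ for $t\notin I$, and for some $\delta\in\mathbb{Z}$ one of them is $a\cdot x\le\delta$ and the other $a\cdot x\ge\delta+1$. Validity of derived $C_k$: ($\mathtt{asm}$) $\mathtt{A}(C_k)=\{k\}$; ($\mathtt{lin}$) $\mathtt{nz}(\lambda)\subseteq[k-1]$, $\mathtt{A}(C_k)=\bigcup_{i\in\mathtt{nz}(\lambda)}\mathtt{A}(C_i)$, combination dominates $C_k$; ($\mathtt{rnd}$) same, combination roundable and its rounding dominates $C_k$; ($\mathtt{uns}$) $i_1,l_1,i_2,l_2<k$, $C_{i_1}$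 and $C_{i_2}$ each dominate $C_k$, $C_{l_1},C_{l_2}$ form a split disjunction, and $\mathtt{A}(C_k)=(\mathtt{A}(C_{i_1})\setminus\{l_1\})\cup(\mathtt{A}(C_{i_2})\setminus\{l_2\})$; ($\mathtt{sol}$) $\mathtt{A}(C_k)=\emptyset$ and for some $sol\in SOL$, $c\cdot x\le c\cdot sol$ (min) or $c\cdot x\ge c\cdot sol$ (max) dominates $C_k$. Predicates: $A_k^j=[j\in\mathtt{A}(C_k)]$; $S_{<k},S_{>k}$ the elements of $S$ below/above $k$. For this $\mathtt{uns}$ constraint, $\phi_{ASM}(k)=\bigwedge_{j\in S_{>k}}\neg A_k^j\wedge\bigwedge_{j\in S_{<k}}\big(A_k^j=(A_{i_1}^j\wedge j\ne l_1)\vee(A_{i_2}^j\wedge j\ne l_2)\big)$. $\phi_{DOM}(C,C')$ for constraints $C=(a,b,s)$, $C'=(a',b',s')$ is $[a=0\wedge(\text{if }s=0\text{ then }b\ne0\text{ else if }s\ge0\text{ then }b>0\text{ else if }s\le0\text{ then }b<0\text{ else false})]\vee[a=a'\wedge(\text{if }s'=0\text{ then }(s=0\wedge b=b')\text{ else if }s'\ge0\text{ then }(s\ge0\wedge b\ge b')\text{ else if }s'\le0\text{ then }(s\le0\wedge b\le b')\text{ else false})]$. $\phi_{DIS}(i,j)=\bigwedge_{t\in[n]}(a_{i,t}=a_{j,t})\wedge\bigwedge_{t\in I}(a_{i,t}\in\mathbb{Z})\wedge\bigwedge_{t\notin I}(a_{i,t}=0)\wedge(b_i\in\mathbb{Z})\wedge(b_j\in\mathbb{Z})\wedge(s(C_i)\ne0\wedge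 s(C_i)+s(C_j)=0)\wedge(\text{if }s(C_i)=1\text{ then }b_i=b_j+1\text{ else }b_i=b_j-1)$.
   Formalization: The numerical data of the program and certificate (the coefficients $a_{i,j}$, right-hand sides $b_i$, objective $c$, multipliers $\lambda$ and the points of $SOL$) are rational instead of real. -}

module Defs where

open import Data.Nat as ℕ using (ℕ)
open import Data.Integer as ℤ using (ℤ; +_; -[1+_])
open import Data.Rational as ℚ using (ℚ; 0ℚ; 1ℚ; _/_; floor; ceiling; _≤ᵇ_)
open import Data.Rational.Properties using (_≟_)
open import Data.Fin as Fin using (Fin; toℕ; inject≤)
open import Data.Bool using (Bool; true; false; _∧_; _∨_; not; if_then_else_)
open import Data.List using (List)
open import Data.List.Membership.Propositional using (_∈_)
open import Data.Maybe using (Maybe; just; nothing)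
open import Data.Product using (Σ; ∃; ∃-syntax; _×_; _,_)
open import Data.Sum using (_⊎_)
open import Data.Empty using (⊥)
open import Relation.Nullary using (¬_)
open import Relation.Nullary.Decidable using (does)
open import Relation.Binary.PropositionalEquality using (_≡_; _≢_)
open import Function.Bundles using (_⇔_)

data Sign : Set where
  le eq ge : Sign

sgnℤ : Sign → ℤ
sgnℤ le = -[1+ 0 ]
sgnℤ eq = + 0
sgnℤ ge = + 1

sgnℚ : Sign → ℚ
sgnℚ le = ℚ.- 1ℚ
sgnℚ eq = 0ℚ
sgnℚ ge = 1ℚ

record Constraint (n : ℕ) : Set where
  constructor mkC
  field
    coef : Fin n → ℚ
    rhs  : ℚ
    sign : Sign
open Constraint public

IsInt : ℚ → Set
IsInt q = ∃[ z ] q ≡ (z / 1)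

Σᶠ : ∀ {d} → (Fin d → ℚ) → ℚ
Σᶠ {ℕ.zero}  f = 0ℚ
Σᶠ {ℕ.suc d} f = f Fin.zero ℚ.+ Σᶠ (λ i → f (Fin.suc i))

allᶠ : ∀ {d} → (Fin d → Bool) → Bool
allᶠ {ℕ.zero}  f = true
allᶠ {ℕ.suc d} f = f Fin.zero ∧ allᶠ (λ i → f (Fin.suc i))

dot : ∀ {n} → (Fin n → ℚ) → (Fin n → ℚ) → ℚ
dot a x = Σᶠ (λ t → a t ℚ.* x t)

Absurd : ∀ {n} → Constraint n → Set
Absurd (mkC a b eq) = (∀ t → a t ≡ 0ℚ) × b ≢ 0ℚ
Absurd (mkC a b ge) = (∀ t → a t ≡ 0ℚ) × (0ℚ ℚ.< b)
Absurd (mkC a b le) = (∀ t → a t ≡ 0ℚ) × (b ℚ.< 0ℚ)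

DomRhs : Sign → ℚ → Sign → ℚ → Set
DomRhs s b eq b' = (s ≡ eq) × (b ≡ b')
DomRhs s b ge b' = (s ≡ eq ⊎ s ≡ ge) × (b' ℚ.≤ b)
DomRhs s b le b' = (s ≡ eq ⊎ s ≡ le) × (b ℚ.≤ b')

Dominates : ∀ {n} → Constraint n → Constraint n → Set
Dominates C C' =
  Absurd C ⊎ ((∀ t → coef C t ≡ coef C' t) × DomRhs (sign C) (rhs C) (sign C') (rhs C'))

-- sign of the combination Σ λ_i C_i (nothing = undefined)
combSign : ∀ {n d} → (Fin d → ℚ) → (Fin d → Constraint n) → Maybe Sign
combSign λv C =
  if allᶠ (λ i → does ((λv i ℚ.* sgnℚ (sign (C i))) ≟ 0ℚ)) then just eq
  else if allᶠ (λ i → 0ℚ ≤ᵇ (λv i ℚ.* sgnℚ (sign (C i)))) then just ge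
  else if allᶠ (λ i → (λv i ℚ.* sgnℚ (sign (C i))) ≤ᵇ 0ℚ) then just le
  else nothing

-- the combination Σ_{i ∈ nz(λ)} λ_i C_i (terms with λ_i = 0 contribute 0)
comb : ∀ {n d} → (Fin d → ℚ) → (Fin d → Constraint n) → Maybe (Constraint n)
comb λv C with combSign λv C
... | nothing = nothing
... | just s  = just (mkC (λ t → Σᶠ (λ i → λv i ℚ.* coef (C i) t))
                          (Σᶠ (λ i → λv i ℚ.* rhs (C i))) s)

Roundable : ∀ {n} → (Fin n → Bool) → Constraint n → Set
Roundable I C =
  (sign C ≢ eq) ×
  (∀ t → I t ≡ true → IsInt (coef C t)) ×
  (∀ t → I t ≡ false → coef C t ≡ 0ℚ)

roundC : ∀ {n} → Constraint n → Constraint n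
roundC (mkC a b ge) = mkC a (ceiling b / 1) ge
roundC (mkC a b le) = mkC a (floor b / 1) le
roundC (mkC a b eq) = mkC a b eq

SplitDisj : ∀ {n} → (Fin n → Bool) → Constraint n → Constraint n → Set
SplitDisj I Ci Cj =
  (∀ t → coef Ci t ≡ coef Cj t) ×
  (∀ t → I t ≡ true → IsInt (coef Ci t)) ×
  (∀ t → I t ≡ false → coef Ci t ≡ 0ℚ) ×
  ∃[ δ ] ( (rhs Ci ≡ δ / 1 × sign Ci ≡ le × rhs Cj ≡ (δ ℤ.+ + 1) / 1 × sign Cj ≡ ge)
         ⊎ (rhs Cj ≡ δ / 1 × sign Cj ≡ le × rhs Ci ≡ (δ ℤ.+ + 1) / 1 × sign Ci ≡ ge))

data Sense : Set where
  min max : Sense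

record IP : Set where
  field
    n      : ℕ
    I      : Fin n → Bool
    c      : Fin n → ℚ
    sense  : Sense
    m      : ℕ
    cons   : Fin m → Constraint n

-- reasons with their data (indices are 0-based: Fin d index k is C_{k+1})
data Reason (d : ℕ) : Set where
  asm : Reason d
  lin : (Fin d → ℚ) → Reason d
  rnd : (Fin d → ℚ) → Reason d
  uns : (i₁ l₁ i₂ l₂ : Fin d) → Reason d
  sol : Reason d

isAsm : ∀ {d} → Reason d → Bool
isAsm asm = true
isAsm _   = false

-- a VIPR certificate for ip (the RTP component plays no role in the
-- validity of derived constraints and is omitted)
record Cert (ip : IP) : Set where
  open IP ip
  field
    d      : ℕ
    m≤d    : m ℕ.≤ d
    C      : Fin d → Constraint n
    C-orig : ∀ (i : Fin m) → C (inject≤ i m≤d) ≡ cons i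
    SOL    : List (Fin n → ℚ)
    reason : Fin d → Reason d                    -- only meaningful for derived constraints
    A      : Fin d → Fin d → Bool                -- A k j ≡ true  iff  j ∈ A(C_k)
    A-orig : ∀ i j → toℕ i ℕ.< m → A i j ≡ false
    A⊆S    : ∀ k j → A k j ≡ true → (m ℕ.≤ toℕ j × isAsm (reason j) ≡ true)

module _ {ip : IP} (cert : Cert ip) where
  open IP ip
  open Cert cert

  InS : Fin d → Set
  InS j = (m ℕ.≤ toℕ j) × (isAsm (reason j) ≡ true)

  objC : (Fin n → ℚ) → Constraint n
  objC s with sense
  ... | min = mkC c (dot c s) le
  ... | max = mkC c (dot c s) ge

  ValidR : (k : Fin d) → Reason d → Set
  ValidR k asm = ∀ j → (A k j ≡ true ⇔ j ≡ k)
  ValidR k (lin λv) =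
    (∀ i → λv i ≢ 0ℚ → i Fin.< k) ×
    (∀ j → (A k j ≡ true ⇔ (∃[ i ] (λv i ≢ 0ℚ × A i j ≡ true)))) ×
    ∃[ D ] (comb λv C ≡ just D × Dominates D (C k))
  ValidR k (rnd λv) =
    (∀ i → λv i ≢ 0ℚ → i Fin.< k) ×
    (∀ j → (A k j ≡ true ⇔ (∃[ i ] (λv i ≢ 0ℚ × A i j ≡ true)))) ×
    ∃[ D ] (comb λv C ≡ just D × Roundable I D × Dominates (roundC D) (C k))
  ValidR k (uns i₁ l₁ i₂ l₂) =
    (i₁ Fin.< k) × (l₁ Fin.< k) × (i₂ Fin.< k) × (l₂ Fin.< k) ×
    Dominates (C i₁) (C k) × Dominates (C i₂) (C k) ×
    SplitDisj I (C l₁) (C l₂) ×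
    (∀ j → (A k j ≡ true ⇔ ((A i₁ j ≡ true × j ≢ l₁) ⊎ (A i₂ j ≡ true × j ≢ l₂))))
  ValidR k sol =
    (∀ j → A k j ≡ false) ×
    ∃[ s ] (s ∈ SOL × Dominates (objC s) (C k))

  Valid : Fin d → Set
  Valid k = ValidR k (reason k)

  Aₚ : Fin d → Fin d → Bool
  Aₚ k j = A k j

  φASM : (k i₁ l₁ i₂ l₂ : Fin d) → Set
  φASM k i₁ l₁ i₂ l₂ =
    (∀ j → InS j → k Fin.< j → Aₚ k j ≡ false) ×
    (∀ j → InS j → j Fin.< k →
       Aₚ k j ≡ ((Aₚ i₁ j ∧ not (does (j Fin.≟ l₁))) ∨ (Aₚ i₂ j ∧ not (does (j Fin.≟ l₂)))))

  φDOM : Constraint n → Constraint n → Set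
  φDOM (mkC a b s) (mkC a' b' s') =
    ((∀ t → a t ≡ 0ℚ) ×
      (if does (sgnℤ s ℤ.≟ + 0) then b ≢ 0ℚ
       else if does (+ 0 ℤ.≤? sgnℤ s) then 0ℚ ℚ.< b
       else if does (sgnℤ s ℤ.≤? + 0) then b ℚ.< 0ℚ
       else ⊥))
    ⊎
    ((∀ t → a t ≡ a' t) ×
      (if does (sgnℤ s' ℤ.≟ + 0) then (sgnℤ s ≡ + 0 × b ≡ b')
       else if does (+ 0 ℤ.≤? sgnℤ s') then (+ 0 ℤ.≤ sgnℤ s × b' ℚ.≤ b)
       else if does (sgnℤ s' ℤ.≤? + 0) then (sgnℤ s ℤ.≤ + 0 × b ℚ.≤ b')
       else ⊥))

  φDIS : Fin d → Fin d → Set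
  φDIS i j =
    (∀ t → coef (C i) t ≡ coef (C j) t) ×
    (∀ t → I t ≡ true → IsInt (coef (C i) t)) ×
    (∀ t → I t ≡ false → coef (C i) t ≡ 0ℚ) ×
    IsInt (rhs (C i)) × IsInt (rhs (C j)) ×
    (sgnℤ (sign (C i)) ≢ + 0 × sgnℤ (sign (C i)) ℤ.+ sgnℤ (sign (C j)) ≡ + 0) ×
    (if does (sgnℤ (sign (C i)) ℤ.≟ + 1) then rhs (C i) ≡ rhs (C j) ℚ.+ 1ℚ
     else rhs (C i) ≡ rhs (C j) ℚ.- 1ℚ)

  φDER : (k i₁ l₁ i₂ l₂ : Fin d) → Set
  φDER k i₁ l₁ i₂ l₂ =
    φASM k i₁ l₁ i₂ l₂ ×
    (i₁ Fin.< k) × (i₂ Fin.< k) × (l₁ Fin.< k) × (l₂ Fin.< k) ×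
    φDOM (C i₁) (C k) × φDOM (C i₂) (C k) × φDIS l₁ l₂

-- Domination and split disjunction are the definitions themselves, once the integer sign tests
-- of φDOM and φDIS are read as sets of signs and δ is recovered from the integral right-hand
-- sides. The assumption condition is the real content: φASM only inspects A_k^j for j ∈ S, and
-- k ∉ S since C_k is an uns step. This loses nothing because every assumption of a valid C_i is
-- C_i itself or inherited from an earlier constraint, so by well-founded induction it has index
-- at most i; hence the assumptions inherited from C_{i₁}, C_{i₂} all lie in S below k.
module Submission where

open import Defs
open import Data.Nat using (_≤_; z≤n; _≤?_)
open import Data.Fin using (Fin; toℕ; _<_)
open import Relation.Binary.PropositionalEquality
  using (_≡_; _≢_; refl; sym; trans; cong; cong₂; module ≡-Reasoning)
open import Function.Bundles using (_⇔_; Equivalence; mk⇔)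

open import Data.Bool using (Bool; true; false; _∧_; _∨_; not; if_then_else_)
open import Data.Bool.Properties using (⇔→≡; ¬-not)
import Data.Fin as Fin
open import Data.Fin.Induction using (<-wellFounded)
open import Data.Fin.Properties using (<-cmp; <-asym; ≤-refl)
open import Data.Integer as ℤ using (+_; +≤+; -≤+)
import Data.Integer.Properties as ℤ
open import Data.Nat.Properties using (≰⇒>; ≤-trans; <-trans; <⇒≤; ≤-<-trans)
open import Data.Product using (_×_; _,_; proj₂; ∃-syntax)
open import Data.Product.Function.NonDependent.Propositional using (_×-⇔_)
open import Data.Rational as ℚ using (ℚ; _/_; toℚᵘ; 1ℚ)
open import Data.Rational.Properties using (toℚᵘ-injective; toℚᵘ-fromℚᵘ; toℚᵘ-homo-+; +-0-abelianGroup)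
open import Data.Rational.Unnormalised as ℚᵘ using (mkℚᵘ)
import Data.Rational.Unnormalised.Properties as ℚᵘ
open import Algebra.Properties.AbelianGroup +-0-abelianGroup using (//-rightDividesˡ; //-rightDividesʳ)
open import Data.Sum using (_⊎_; inj₁; inj₂; [_,_])
open import Data.Sum.Function.Propositional using (_⊎-⇔_)
open import Function using (id; const)
open import Function.Construct.Composition using (_⇔-∘_)
open import Function.Construct.Identity using (⇔-id)
open import Function.Construct.Symmetry using (⇔-sym)
open import Induction.WellFounded using (Acc; acc)
open import Relation.Binary using (tri<; tri≈; tri>)
open import Relation.Nullary using (¬_; Dec; yes; no; does; contradiction)

open Equivalence using (to; from)

/1-homo-+ : ∀ i j → (i ℤ.+ j) / 1 ≡ i / 1 ℚ.+ j / 1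
/1-homo-+ i j = toℚᵘ-injective (begin
  toℚᵘ ((i ℤ.+ j) / 1)            ≈⟨ toℚᵘ-fromℚᵘ (mkℚᵘ (i ℤ.+ j) 0) ⟩
  mkℚᵘ (i ℤ.+ j) 0                ≡⟨ cong₂ (λ a b → mkℚᵘ (a ℤ.+ b) 0) (ℤ.*-identityʳ i) (ℤ.*-identityʳ j) ⟨
  mkℚᵘ i 0 ℚᵘ.+ mkℚᵘ j 0          ≈⟨ ℚᵘ.+-cong (toℚᵘ-fromℚᵘ (mkℚᵘ i 0)) (toℚᵘ-fromℚᵘ (mkℚᵘ j 0)) ⟨
  toℚᵘ (i / 1) ℚᵘ.+ toℚᵘ (j / 1)  ≈⟨ toℚᵘ-homo-+ (i / 1) (j / 1) ⟨
  toℚᵘ (i / 1 ℚ.+ j / 1)          ∎)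
  where open ℚᵘ.≃-Reasoning

∨-≡-true : ∀ x {y} → x ∨ y ≡ true ⇔ (x ≡ true ⊎ y ≡ true)
∨-≡-true true  = mk⇔ inj₁ (const refl)
∨-≡-true false = mk⇔ inj₂ [ (λ ()) , id ]

∧-not-does-≡-true : ∀ {P : Set} x (P? : Dec P) → x ∧ not (does P?) ≡ true ⇔ (x ≡ true × ¬ P)
∧-not-does-≡-true true  (yes p) = mk⇔ (λ ()) (λ (_ , ¬p) → contradiction p ¬p)
∧-not-does-≡-true true  (no ¬p) = mk⇔ (const (refl , ¬p)) (const refl)
∧-not-does-≡-true false P?      = mk⇔ (λ ()) (λ { (() , _) })

sgnℤ≡0⇔≡eq : ∀ s → sgnℤ s ≡ + 0 ⇔ s ≡ eq
sgnℤ≡0⇔≡eq le = mk⇔ (λ ()) (λ ())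
sgnℤ≡0⇔≡eq eq = mk⇔ (const refl) (const refl)
sgnℤ≡0⇔≡eq ge = mk⇔ (λ ()) (λ ())

0≤sgnℤ⇔≡eq⊎≡ge : ∀ s → + 0 ℤ.≤ sgnℤ s ⇔ (s ≡ eq ⊎ s ≡ ge)
0≤sgnℤ⇔≡eq⊎≡ge le = mk⇔ (λ ()) [ (λ ()) , (λ ()) ]
0≤sgnℤ⇔≡eq⊎≡ge eq = mk⇔ (const (inj₁ refl)) (const (+≤+ z≤n))
0≤sgnℤ⇔≡eq⊎≡ge ge = mk⇔ (const (inj₂ refl)) (const (+≤+ z≤n))

sgnℤ≤0⇔≡eq⊎≡le : ∀ s → sgnℤ s ℤ.≤ + 0 ⇔ (s ≡ eq ⊎ s ≡ le)
sgnℤ≤0⇔≡eq⊎≡le le = mk⇔ (const (inj₂ refl)) (const -≤+)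
sgnℤ≤0⇔≡eq⊎≡le eq = mk⇔ (const (inj₁ refl)) (const (+≤+ z≤n))
sgnℤ≤0⇔≡eq⊎≡le ge = mk⇔ (λ { (+≤+ ()) }) [ (λ ()) , (λ ()) ]

-- The right-hand-side and sign parts of SplitDisj and φDIS; their coefficient parts coincide.
SplitSides : ℚ → Sign → ℚ → Sign → Set
SplitSides b s b' s' =
  ∃[ δ ] ( (b ≡ δ / 1 × s ≡ le × b' ≡ (δ ℤ.+ + 1) / 1 × s' ≡ ge)
         ⊎ (b' ≡ δ / 1 × s' ≡ le × b ≡ (δ ℤ.+ + 1) / 1 × s ≡ ge))

IntegralUnitGap : ℚ → Sign → ℚ → Sign → Set
IntegralUnitGap b s b' s' =
  IsInt b × IsInt b' × (sgnℤ s ≢ + 0 × sgnℤ s ℤ.+ sgnℤ s' ≡ + 0) ×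
  (if does (sgnℤ s ℤ.≟ + 1) then b ≡ b' ℚ.+ 1ℚ else b ≡ b' ℚ.- 1ℚ)

splitSides⇒integralUnitGap : ∀ {b s b' s'} → SplitSides b s b' s' → IntegralUnitGap b s b' s'
splitSides⇒integralUnitGap (δ , inj₁ (refl , refl , refl , refl)) =
  (δ , refl) , (δ ℤ.+ + 1 , refl) , ((λ ()) , refl) , (begin
    δ / 1                         ≡⟨ //-rightDividesʳ 1ℚ (δ / 1) ⟨
    δ / 1 ℚ.+ 1ℚ ℚ.- 1ℚ           ≡⟨ cong (ℚ._- 1ℚ) (/1-homo-+ δ (+ 1)) ⟨
    (δ ℤ.+ + 1) / 1 ℚ.- 1ℚ        ∎)
  where open ≡-Reasoning
splitSides⇒integralUnitGap (δ , inj₂ (refl , refl , refl , refl)) =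
  (δ ℤ.+ + 1 , refl) , (δ , refl) , ((λ ()) , refl) , /1-homo-+ δ (+ 1)

integralUnitGap⇒splitSides : ∀ {b s b' s'} → IntegralUnitGap b s b' s' → SplitSides b s b' s'
integralUnitGap⇒splitSides {b} {le} {b'} {ge} ((δ , b≡δ) , _ , _ , b≡b'-1) =
  δ , inj₁ (b≡δ , refl , (begin
    b'                    ≡⟨ //-rightDividesˡ 1ℚ b' ⟨
    b' ℚ.- 1ℚ ℚ.+ 1ℚ      ≡⟨ cong (ℚ._+ 1ℚ) (trans (sym b≡b'-1) b≡δ) ⟩
    δ / 1 ℚ.+ 1ℚ          ≡⟨ /1-homo-+ δ (+ 1) ⟨
    (δ ℤ.+ + 1) / 1       ∎) , refl)
  where open ≡-Reasoning
integralUnitGap⇒splitSides {b} {ge} {b'} {le} (_ , (δ , b'≡δ) , _ , b≡b'+1) =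
  δ , inj₂ (b'≡δ , refl , trans b≡b'+1 (trans (cong (ℚ._+ 1ℚ) b'≡δ) (sym (/1-homo-+ δ (+ 1)))) , refl)
integralUnitGap⇒splitSides {s = eq} (_ , _ , (s≢0 , _) , _) = contradiction refl s≢0
integralUnitGap⇒splitSides {s = le} {s' = le} (_ , _ , (_ , ()) , _)
integralUnitGap⇒splitSides {s = le} {s' = eq} (_ , _ , (_ , ()) , _)
integralUnitGap⇒splitSides {s = ge} {s' = ge} (_ , _ , (_ , ()) , _)
integralUnitGap⇒splitSides {s = ge} {s' = eq} (_ , _ , (_ , ()) , _)

module _ {ip : IP} (cert : Cert ip) where
  open IP ip
  open Cert cert

  dominates⇔φDOM : ∀ (X Y : Constraint n) → Dominates X Y ⇔ φDOM cert X Y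
  dominates⇔φDOM (mkC _ _ le) (mkC _ _ eq) = ⇔-id _ ⊎-⇔ (⇔-id _ ×-⇔ (⇔-sym (sgnℤ≡0⇔≡eq le) ×-⇔ ⇔-id _))
  dominates⇔φDOM (mkC _ _ eq) (mkC _ _ eq) = ⇔-id _ ⊎-⇔ (⇔-id _ ×-⇔ (⇔-sym (sgnℤ≡0⇔≡eq eq) ×-⇔ ⇔-id _))
  dominates⇔φDOM (mkC _ _ ge) (mkC _ _ eq) = ⇔-id _ ⊎-⇔ (⇔-id _ ×-⇔ (⇔-sym (sgnℤ≡0⇔≡eq ge) ×-⇔ ⇔-id _))
  dominates⇔φDOM (mkC _ _ le) (mkC _ _ ge) = ⇔-id _ ⊎-⇔ (⇔-id _ ×-⇔ (⇔-sym (0≤sgnℤ⇔≡eq⊎≡ge le) ×-⇔ ⇔-id _))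
  dominates⇔φDOM (mkC _ _ eq) (mkC _ _ ge) = ⇔-id _ ⊎-⇔ (⇔-id _ ×-⇔ (⇔-sym (0≤sgnℤ⇔≡eq⊎≡ge eq) ×-⇔ ⇔-id _))
  dominates⇔φDOM (mkC _ _ ge) (mkC _ _ ge) = ⇔-id _ ⊎-⇔ (⇔-id _ ×-⇔ (⇔-sym (0≤sgnℤ⇔≡eq⊎≡ge ge) ×-⇔ ⇔-id _))
  dominates⇔φDOM (mkC _ _ le) (mkC _ _ le) = ⇔-id _ ⊎-⇔ (⇔-id _ ×-⇔ (⇔-sym (sgnℤ≤0⇔≡eq⊎≡le le) ×-⇔ ⇔-id _))
  dominates⇔φDOM (mkC _ _ eq) (mkC _ _ le) = ⇔-id _ ⊎-⇔ (⇔-id _ ×-⇔ (⇔-sym (sgnℤ≤0⇔≡eq⊎≡le eq) ×-⇔ ⇔-id _))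
  dominates⇔φDOM (mkC _ _ ge) (mkC _ _ le) = ⇔-id _ ⊎-⇔ (⇔-id _ ×-⇔ (⇔-sym (sgnℤ≤0⇔≡eq⊎≡le ge) ×-⇔ ⇔-id _))

  splitDisj⇔φDIS : ∀ i j → SplitDisj I (C i) (C j) ⇔ φDIS cert i j
  splitDisj⇔φDIS i j =
    ⇔-id _ ×-⇔ ⇔-id _ ×-⇔ ⇔-id _ ×-⇔ mk⇔ splitSides⇒integralUnitGap integralUnitGap⇒splitSides

  assumption-source : ∀ {i j r} → ValidR cert i r → A i j ≡ true → j ≡ i ⊎ ∃[ i' ] (i' < i × A i' j ≡ true)
  assumption-source {r = asm}             v Aij = inj₁ (to (v _) Aij)
  assumption-source {r = lin _}           (nz<i , A⇔ , _) Aij with (i' , nz , Ai'j) ← to (A⇔ _) Aij =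
    inj₂ (i' , nz<i i' nz , Ai'j)
  assumption-source {r = rnd _}           (nz<i , A⇔ , _) Aij with (i' , nz , Ai'j) ← to (A⇔ _) Aij =
    inj₂ (i' , nz<i i' nz , Ai'j)
  assumption-source {r = uns i₁ _ i₂ _} (i₁<i , _ , i₂<i , _ , _ , _ , _ , A⇔) Aij with to (A⇔ _) Aij
  ... | inj₁ (Ai₁j , _) = inj₂ (i₁ , i₁<i , Ai₁j)
  ... | inj₂ (Ai₂j , _) = inj₂ (i₂ , i₂<i , Ai₂j)
  assumption-source {r = sol}             (A≡false , _) Aij = contradiction (trans (sym (A≡false _)) Aij) λ ()

  module _ (k : Fin d) (valid-below : ∀ j → m ≤ toℕ j → j < k → Valid cert j) where

    assumption≤ : ∀ {i j} → i < k → A i j ≡ true → j Fin.≤ i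
    assumption≤ {i} = go (<-wellFounded i)
      where
      go : ∀ {i j} → Acc _<_ i → i < k → A i j ≡ true → j Fin.≤ i
      go {i} {j} (acc below) i<k Aij with m ≤? toℕ i
      ... | no i<m = contradiction (trans (sym (A-orig i j (≰⇒> i<m))) Aij) λ ()
      ... | yes m≤i with assumption-source (valid-below i m≤i i<k) Aij
      ...   | inj₁ refl = ≤-refl
      ...   | inj₂ (i' , i'<i , Ai'j) = ≤-trans (go (below i'<i) (<-trans i'<i i<k) Ai'j) (<⇒≤ i'<i)

    module _ {i₁ l₁ i₂ l₂ : Fin d} (reason-k : reason k ≡ uns i₁ l₁ i₂ l₂) (i₁<k : i₁ < k) (i₂<k : i₂ < k) where

      Inherited : Fin d → Set
      Inherited j = (A i₁ j ≡ true × j ≢ l₁) ⊎ (A i₂ j ≡ true × j ≢ l₂)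

      inherited? : Fin d → Bool
      inherited? j = (A i₁ j ∧ not (does (j Fin.≟ l₁))) ∨ (A i₂ j ∧ not (does (j Fin.≟ l₂)))

      inherited?⇔Inherited : ∀ j → inherited? j ≡ true ⇔ Inherited j
      inherited?⇔Inherited j =
        (∧-not-does-≡-true (A i₁ j) (j Fin.≟ l₁) ⊎-⇔ ∧-not-does-≡-true (A i₂ j) (j Fin.≟ l₂))
          ⇔-∘ ∨-≡-true (A i₁ j ∧ not (does (j Fin.≟ l₁)))

      UnsAssumptions : Set
      UnsAssumptions = ∀ j → A k j ≡ true ⇔ Inherited j

      inherited⇒InS×<k : ∀ {j} → Inherited j → InS cert j × j < k
      inherited⇒InS×<k (inj₁ (Ai₁j , _)) = A⊆S i₁ _ Ai₁j , ≤-<-trans (assumption≤ i₁<k Ai₁j) i₁<k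
      inherited⇒InS×<k (inj₂ (Ai₂j , _)) = A⊆S i₂ _ Ai₂j , ≤-<-trans (assumption≤ i₂<k Ai₂j) i₂<k

      unsAssumptions⇔φASM : UnsAssumptions ⇔ φASM cert k i₁ l₁ i₂ l₂
      unsAssumptions⇔φASM =
        mk⇔ (λ A⇔ → none-above A⇔ , matches-below A⇔) (λ φ j → mk⇔ (own⇒inherited φ) (inherited⇒own φ))
        where
        none-above : UnsAssumptions → ∀ j → InS cert j → k < j → A k j ≡ false
        none-above A⇔ j _ k<j = ¬-not λ Akj → <-asym k<j (proj₂ (inherited⇒InS×<k (to (A⇔ j) Akj)))

        matches-below : UnsAssumptions → ∀ j → InS cert j → j < k → A k j ≡ inherited? j
        matches-below A⇔ j _ _ = ⇔→≡ (⇔-sym (inherited?⇔Inherited j) ⇔-∘ A⇔ j)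

        own⇒inherited : φASM cert k i₁ l₁ i₂ l₂ → ∀ {j} → A k j ≡ true → Inherited j
        own⇒inherited (above , below) {j} Akj with A⊆S k j Akj | <-cmp j k
        ... | j∈S | tri< j<k _ _ = to (inherited?⇔Inherited j) (trans (sym (below j j∈S j<k)) Akj)
        ... | (_ , asm-k) | tri≈ _ refl _ = contradiction (trans (sym (cong isAsm reason-k)) asm-k) λ ()
        ... | j∈S | tri> _ _ k<j = contradiction (trans (sym (above j j∈S k<j)) Akj) λ ()

        inherited⇒own : φASM cert k i₁ l₁ i₂ l₂ → ∀ {j} → Inherited j → A k j ≡ true
        inherited⇒own (_ , below) {j} inh with (j∈S , j<k) ← inherited⇒InS×<k inh =
          trans (below j j∈S j<k) (from (inherited?⇔Inherited j) inh)

lemma11 : (ip : IP) (cert : Cert ip) →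
          (k i₁ l₁ i₂ l₂ : Fin (Cert.d cert)) →
          IP.m ip ≤ toℕ k →
          Cert.reason cert k ≡ uns i₁ l₁ i₂ l₂ →
          (∀ (j : Fin (Cert.d cert)) → IP.m ip ≤ toℕ j → j < k → Valid cert j) →
          (Valid cert k ⇔ φDER cert k i₁ l₁ i₂ l₂)
lemma11 ip cert k i₁ l₁ i₂ l₂ _ reason-k valid-below rewrite reason-k = mk⇔ valid⇒φDER φDER⇒valid
  where
  valid⇒φDER : ValidR cert k (uns i₁ l₁ i₂ l₂) → φDER cert k i₁ l₁ i₂ l₂
  valid⇒φDER (i₁<k , l₁<k , i₂<k , l₂<k , dom₁ , dom₂ , split , A⇔) =
    to (unsAssumptions⇔φASM cert k valid-below reason-k i₁<k i₂<k) A⇔ ,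
    i₁<k , i₂<k , l₁<k , l₂<k ,
    to (dominates⇔φDOM cert _ _) dom₁ , to (dominates⇔φDOM cert _ _) dom₂ ,
    to (splitDisj⇔φDIS cert l₁ l₂) split

  φDER⇒valid : φDER cert k i₁ l₁ i₂ l₂ → ValidR cert k (uns i₁ l₁ i₂ l₂)
  φDER⇒valid (φasm , i₁<k , i₂<k , l₁<k , l₂<k , φdom₁ , φdom₂ , φdis) =
    i₁<k , l₁<k , i₂<k , l₂<k ,
    from (dominates⇔φDOM cert _ _) φdom₁ , from (dominates⇔φDOM cert _ _) φdom₂ ,
    from (splitDisj⇔φDIS cert l₁ l₂) φdis ,
    from (unsAssumptions⇔φASM cert k valid-below reason-k i₁<k i₂<k) φasm
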